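{- The rules (mix) and (sc$_n$) (for each $n\ge2$) are $GK(A_m)^r$-admissible; that is, for all finite multisets $\Gamma,\Delta,\Pi,\Sigma$ of $\mathcal{L}_{A_m}^{\Box}$-formulas: if $\Gamma\Rightarrow\Delta$ and $\Pi\Rightarrow\Sigma$ are $GK(A_m)^r$-derivable then so is $\Gamma,\Pi\Rightarrow\Sigma,\Delta$; and if $n\Gamma\Rightarrow n\Delta$ is $GK(A_m)^r$-derivable for some $n\ge2$ then so is $\Gamma\Rightarrow\Delta$.
   Context: $\mathcal{L}_{A_m}^{\Box}$-formulas are built from a countably infinite set of variables using binary $\to$ and unary $\Box$. A sequent $\Gamma\Rightarrow\Delta$ is an ordered pair of finite multisets of formulas; $\Gamma,\Delta$ denotes multiset union ($\uplus$), $k\Gamma$ the union of $k$ copies of $\Gamma$, $k[\varphi]$ the multiset of $k$ copies of $\varphi$, $\Box\Gamma=[\Box\varphi:\varphi\in\Gamma]$. The calculus $GK(A_m)^r$ has exactly the rules: (ID) $\Delta\Rightarrow\Delta$ (no premises); ($\to\Rightarrow$) from $\Gamma,\psi\Rightarrow\varphi,\Delta$ infer $\Gamma,\varphi\to\psi\Rightarrow\Delta$; ($\Rightarrow\to$) from $\Gamma,\varphi\Rightarrow\psi,\Delta$ infer $\Gamma\Rightarrow\varphi\to\psi,\Delta$; and for each $k\ge1$, $n\ge0$, ($\Box_{k,n}$): from the premises $\Gamma_0\Rightarrow$ and $\Gamma_i\Rightarrow k[\varphi_i]$ for $i=1,\dots,n$ infer $\Delta,\Box\Gamma\Rightarrow\Box\varphi_1,\dots,\Box\varphi_n,\Delta$,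 provided $k\Gamma=\Gamma_0\uplus\Gamma_1\uplus\dots\uplus\Gamma_n$. A sequent is $GK(A_m)^r$-derivable if it is the root of a finite tree of sequents each node of which is obtained from its children by one of these rules. -}

module Defs where

open import Data.Nat using (ℕ; _≤_)
open import Data.List using (List; []; _∷_; _++_; map; concat; replicate)
open import Data.List.Relation.Unary.All using (All)
open import Data.List.Relation.Binary.Permutation.Propositional using (_↭_)
open import Data.Product using (_×_; proj₁; proj₂)

data Formula : Set where
  var : ℕ → Formula
  _⇒_ : Formula → Formula → Formula
  □_  : Formula → Formula

infixr 5 _⇒_

-- Finite multisets are represented by lists, considered up to permutation (_↭_).
-- k Γ : the multiset union of k copies of Γ.
copies : ℕ → List Formula → List Formula
copies k Γ = concat (replicate k Γ)

boxes : List Formula → List Formula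
boxes = map □_

-- Derivability in GK(A_m)^r of the sequent Γ ⇒ Δ.  Every rule's conclusion
-- is only determined up to multiset equality, hence the ↭ side conditions.
data GK : List Formula → List Formula → Set where
  ID : ∀ {Γ Δ} → Γ ↭ Δ → GK Γ Δ
  →⇒ : ∀ {Γ Δ φ ψ Γc Δc} →
       GK (ψ ∷ Γ) (φ ∷ Δ) →
       Γc ↭ ((φ ⇒ ψ) ∷ Γ) → Δc ↭ Δ → GK Γc Δc
  ⇒→ : ∀ {Γ Δ φ ψ Γc Δc} →
       GK (φ ∷ Γ) (ψ ∷ Δ) →
       Γc ↭ Γ → Δc ↭ ((φ ⇒ ψ) ∷ Δ) → GK Γc Δc
  -- (□_{k,n}): the list ps = [(Γ₁,φ₁),…,(Γₙ,φₙ)] (n = its length),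
  -- premises Γ₀ ⇒ and Γᵢ ⇒ k[φᵢ], side condition kΓ = Γ₀ ⊎ Γ₁ ⊎ … ⊎ Γₙ,
  -- conclusion Δ, □Γ ⇒ □φ₁,…,□φₙ, Δ.
  □rule : ∀ {k Γ Δ Γ₀ Γc Δc} (ps : List (List Formula × Formula)) →
       1 ≤ k →
       copies k Γ ↭ (Γ₀ ++ concat (map proj₁ ps)) →
       GK Γ₀ [] →
       All (λ p → GK (proj₁ p) (replicate k (proj₂ p))) ps →
       Γc ↭ (Δ ++ boxes Γ) →
       Δc ↭ (boxes (map proj₂ ps) ++ Δ) →
       GK Γc Δc

-- Mix is proved by induction on the nesting depth of □ rules.  The only
-- interesting case joins two □ inferences of multiplicities k₁ and k₂: scaling
-- the premises of each by the other multiplicity (scaling is mix of a derivation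
-- with itself, at smaller depth) makes both multiplicities k₂ k₁, and the
-- premises can then be pooled into one □ inference for the mixed conclusion.
--
-- For (sc) the implication rules are invertible (by mix), so all implications
-- can be decomposed; on sequents without implications the last rule of a
-- derivation of (n+1)Γ ⊢ (n+1)Δ is an identity, which cancels, or a □ rule.  In
-- the latter the boxed context is made principal with identity premises, the
-- n+1 premises for the copies of each boxed formula of Δ are mixed into one, and
-- the result is a □ inference of multiplicity (n+1)k concluding Γ ⊢ Δ.
module Submission where

open import Defs
open import Data.Nat using (ℕ; zero; suc; _+_; _*_; _≤_; _<_; _⊔_; s≤s; z≤n)
open import Data.Nat.Properties using (*-comm; *-mono-≤; m≤m⊔n; m≤n⊔m; +-assoc; ≤-reflexive)
open import Data.Nat.Induction using (<-wellFounded)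
open import Data.Nat.ListAction using (sum)
open import Data.Nat.ListAction.Properties using (sum-↭)
open import Data.List using (List; []; _∷_; _++_; [_]; map; concat; concatMap; replicate)
import Data.List.Properties as List
open import Data.List.Relation.Unary.All as All using (All; []; _∷_)
import Data.List.Relation.Unary.All.Properties as All
open import Data.List.Relation.Unary.Any using (Any; here; there; any?)
open import Data.List.Membership.Propositional using (_∈_; _∉_; find; lose)
open import Data.List.Membership.Propositional.Properties using (∈-∃++; ∈-++⁻; ∈-map⁻)
open import Data.List.Relation.Binary.Permutation.Propositional as Perm
  using (_↭_; ↭-refl; ↭-sym; ↭-trans; ↭-reflexive; prep; swap)
open import Data.List.Relation.Binary.Permutation.Propositional.Properties
  using (++⁺ˡ; ++⁺ʳ; ++⁺; shift; shifts; drop-∷; ∈-resp-↭; All-resp-↭; ↭-empty-inv; ↭-map-inv)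
  renaming (++-comm to ↭-++-comm; map⁺ to ↭-map⁺)
open import Data.Product using (_×_; _,_; proj₁; proj₂; ∃; ∃₂; map₁)
open import Data.Sum using (inj₁; inj₂)
open import Data.Empty using (⊥-elim)
open import Induction.WellFounded using (Acc; acc)
open import Relation.Nullary using (¬_; yes; no)
open import Relation.Unary using (Decidable)
open import Relation.Binary.PropositionalEquality using (_≡_; refl; sym; trans; cong; cong₂; subst)

private
  variable
    A : Set
    k m n : ℕ
    φ ψ : Formula
    Γ Δ Π Σ Φ Γ′ Δ′ Φ′ Γc Δc : List Formula

infixr 4 _∙_
_∙_ : {xs ys zs : List A} → xs ↭ ys → ys ↭ zs → xs ↭ zs
_∙_ = ↭-trans

++-interchange : (ws xs ys zs : List A) → (ws ++ xs) ++ (ys ++ zs) ↭ (ws ++ ys) ++ (xs ++ zs)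
++-interchange ws xs ys zs =
  ↭-reflexive (List.++-assoc ws xs (ys ++ zs)) ∙ ++⁺ˡ ws (shifts xs ys)
  ∙ ↭-sym (↭-reflexive (List.++-assoc ws ys (xs ++ zs)))

++-cancelˡ : ∀ (xs : List A) {ys zs} → xs ++ ys ↭ xs ++ zs → ys ↭ zs
++-cancelˡ []       p = p
++-cancelˡ (x ∷ xs) p = ++-cancelˡ xs (drop-∷ p)

∈⇒↭∷ : {x : A} {xs : List A} → x ∈ xs → ∃ λ ys → xs ↭ x ∷ ys
∈⇒↭∷ {x = x} x∈xs with ys , zs , refl ← ∈-∃++ x∈xs = ys ++ zs , shift x ys zs

map-≡-++ : ∀ {B : Set} (f : A → B) xs ys zs → map f zs ≡ xs ++ ys →
           ∃₂ λ zs₁ zs₂ → zs ≡ zs₁ ++ zs₂ × map f zs₁ ≡ xs × map f zs₂ ≡ ys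
map-≡-++ f []       ys zs       eq = [] , zs , refl , refl , eq
map-≡-++ f (x ∷ xs) ys (z ∷ zs) eq
  with fz≡x , eq′ ← List.∷-injective eq
  with zs₁ , zs₂ , refl , eq₁ , eq₂ ← map-≡-++ f xs ys zs eq′
  = z ∷ zs₁ , zs₂ , refl , cong₂ _∷_ fz≡x eq₁ , eq₂

copies-[] : ∀ k → copies k [] ≡ []
copies-[] zero    = refl
copies-[] (suc k) = copies-[] k

copies-+ : ∀ a b Γ → copies (a + b) Γ ≡ copies a Γ ++ copies b Γ
copies-+ zero    b Γ = refl
copies-+ (suc a) b Γ = trans (cong (Γ ++_) (copies-+ a b Γ)) (sym (List.++-assoc Γ (copies a Γ) (copies b Γ)))

copies-* : ∀ a b Γ → copies (a * b) Γ ≡ copies a (copies b Γ)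
copies-* zero    b Γ = refl
copies-* (suc a) b Γ = trans (copies-+ b (a * b) Γ) (cong (copies b Γ ++_) (copies-* a b Γ))

copies-comm : ∀ a b Γ → copies a (copies b Γ) ≡ copies b (copies a Γ)
copies-comm a b Γ = trans (sym (copies-* a b Γ)) (trans (cong (λ c → copies c Γ) (*-comm a b)) (copies-* b a Γ))

copies-[_] : ∀ φ k → copies k [ φ ] ≡ replicate k φ
copies-[ φ ] zero    = refl
copies-[ φ ] (suc k) = cong (φ ∷_) (copies-[ φ ] k)

copies-replicate : ∀ j k φ → copies j (replicate k φ) ≡ replicate (j * k) φ
copies-replicate j k φ =
  trans (cong (copies j) (sym (copies-[ φ ] k))) (trans (sym (copies-* j k [ φ ])) (copies-[ φ ] (j * k)))

copies⁺ : ∀ k → Γ ↭ Δ → copies k Γ ↭ copies k Δ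
copies⁺ zero    p = ↭-refl
copies⁺ (suc k) p = ++⁺ p (copies⁺ k p)

copies-++ : ∀ k Γ Δ → copies k (Γ ++ Δ) ↭ copies k Γ ++ copies k Δ
copies-++ zero    Γ Δ = ↭-refl
copies-++ (suc k) Γ Δ = ++⁺ˡ (Γ ++ Δ) (copies-++ k Γ Δ) ∙ ++-interchange Γ Δ (copies k Γ) (copies k Δ)

copies-∷ : ∀ k φ Γ → copies k (φ ∷ Γ) ↭ replicate k φ ++ copies k Γ
copies-∷ zero    φ Γ = ↭-refl
copies-∷ (suc k) φ Γ = prep φ (++⁺ˡ Γ (copies-∷ k φ Γ) ∙ shifts Γ (replicate k φ))

copies↭concatMap-replicate : ∀ k Γ → copies k Γ ↭ concatMap (replicate k) Γ
copies↭concatMap-replicate k []      = ↭-reflexive (copies-[] k)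
copies↭concatMap-replicate k (φ ∷ Γ) = copies-∷ k φ Γ ∙ ++⁺ˡ (replicate k φ) (copies↭concatMap-replicate k Γ)

∈-copies⁻ : ∀ k → φ ∈ copies k Γ → φ ∈ Γ
∈-copies⁻ {Γ = Γ} (suc k) φ∈ with ∈-++⁻ Γ φ∈
... | inj₁ φ∈Γ = φ∈Γ
... | inj₂ φ∈  = ∈-copies⁻ k φ∈

copies-cancel : ∀ n {Γ Δ} → copies (suc n) Γ ↭ copies (suc n) Δ → Γ ↭ Δ
copies-cancel n {[]} {Δ} p =
  ↭-reflexive (sym (List.++-conicalˡ Δ _ (↭-empty-inv (↭-sym p ∙ ↭-reflexive (copies-[] n)))))
copies-cancel n {φ ∷ Γ} {Δ} p
  with Δ′ , Δ↭ ← ∈⇒↭∷ (∈-copies⁻ (suc n) (∈-resp-↭ p (here refl))) =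
  prep φ (copies-cancel n (++-cancelˡ (replicate (suc n) φ)
           (↭-sym (copies-∷ (suc n) φ Γ) ∙ p ∙ copies⁺ (suc n) Δ↭ ∙ copies-∷ (suc n) φ Δ′)))
  ∙ ↭-sym Δ↭

concatMap⁺ : ∀ {B : Set} (f : A → List B) {xs ys} → xs ↭ ys → concatMap f xs ↭ concatMap f ys
concatMap⁺ f Perm.refl         = ↭-refl
concatMap⁺ f (prep φ p)        = ++⁺ˡ (f φ) (concatMap⁺ f p)
concatMap⁺ f (swap φ ψ p)      = ++⁺ˡ (f φ) (++⁺ˡ (f ψ) (concatMap⁺ f p)) ∙ shifts (f φ) (f ψ)
concatMap⁺ f (Perm.trans p q)  = concatMap⁺ f p ∙ concatMap⁺ f q

concatMap-copies : ∀ (f : Formula → List Formula) k Γ → concatMap f (copies k Γ) ≡ copies k (concatMap f Γ)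
concatMap-copies f zero    Γ = refl
concatMap-copies f (suc k) Γ =
  trans (List.concatMap-++ f Γ (copies k Γ)) (cong (concatMap f Γ ++_) (concatMap-copies f k Γ))

concatMap-copies⁺ : ∀ (f : Formula → List Formula) k →
                    copies k Γ ↭ Δ → copies k (concatMap f Γ) ↭ concatMap f Δ
concatMap-copies⁺ {Γ = Γ} f k p = ↭-reflexive (sym (concatMap-copies f k Γ)) ∙ concatMap⁺ f p

GK-resp-↭ : Γ ↭ Γ′ → Δ ↭ Δ′ → GK Γ Δ → GK Γ′ Δ′
GK-resp-↭ a b (ID p)                     = ID (↭-sym a ∙ p ∙ b)
GK-resp-↭ a b (→⇒ d p q)                 = →⇒ d (↭-sym a ∙ p) (↭-sym b ∙ q)
GK-resp-↭ a b (⇒→ d p q)                 = ⇒→ d (↭-sym a ∙ p) (↭-sym b ∙ q)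
GK-resp-↭ a b (□rule ps k≥1 e d₀ ds p q) = □rule ps k≥1 e d₀ ds (↭-sym a ∙ p) (↭-sym b ∙ q)

Derivable : Set₁
Derivable = List Formula → List Formula → Set

Premise : Derivable → ℕ → List Formula × Formula → Set
Premise D k p = D (proj₁ p) (replicate k (proj₂ p))

record □Premises (D : Derivable) (k : ℕ) (Γ Φ : List Formula) : Set where
  constructor □premises
  field
    Γ₀          : List Formula
    pairs       : List (List Formula × Formula)
    split       : copies k Γ ↭ Γ₀ ++ concatMap proj₁ pairs
    conclusions : map proj₂ pairs ↭ Φ
    Γ₀-premise  : D Γ₀ []
    premises    : All (Premise D k) pairs

□-rule : ∀ {C} → 1 ≤ k → □Premises GK k Γ Φ → Γc ↭ C ++ boxes Γ → Δc ↭ boxes Φ ++ C → GK Γc Δc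
□-rule {C = C} k≥1 (□premises _ ps e c d₀ ds) p q =
  □rule ps k≥1 e d₀ ds p (q ∙ ++⁺ʳ C (↭-map⁺ □_ (↭-sym c)))

□Premises-resp-↭ : ∀ {D} → Γ ↭ Γ′ → Φ ↭ Φ′ → □Premises D k Γ Φ → □Premises D k Γ′ Φ′
□Premises-resp-↭ {k = k} a b (□premises Γ₀ ps e c d₀ ds) =
  □premises Γ₀ ps (copies⁺ k (↭-sym a) ∙ e) (c ∙ b) d₀ ds

concatMap-scaled : ∀ j (ps : List (List Formula × Formula)) →
                   concatMap proj₁ (map (map₁ (copies j)) ps) ↭ copies j (concatMap proj₁ ps)
concatMap-scaled j []       = ↭-reflexive (sym (copies-[] j))
concatMap-scaled j (p ∷ ps) =
  ++⁺ˡ (copies j (proj₁ p)) (concatMap-scaled j ps) ∙ ↭-sym (copies-++ j (proj₁ p) (concatMap proj₁ ps))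

□Premises-scale : ∀ {D} j → (∀ {X Y} → D X Y → D (copies j X) (copies j Y)) →
                  □Premises D k Γ Φ → □Premises D (j * k) Γ Φ
□Premises-scale {k = k} {Γ = Γ} {D = D} j scale (□premises Γ₀ ps e c d₀ ds) =
  □premises (copies j Γ₀) (map (map₁ (copies j)) ps) split
    (↭-reflexive (sym (List.map-∘ ps)) ∙ c)
    (subst (D (copies j Γ₀)) (copies-[] j) (scale d₀))
    (All.map⁺ (All.map scale-premise ds))
  where
  split : copies (j * k) Γ ↭ copies j Γ₀ ++ concatMap proj₁ (map (map₁ (copies j)) ps)
  split = ↭-reflexive (copies-* j k Γ) ∙ copies⁺ j e ∙ copies-++ j Γ₀ (concatMap proj₁ ps)
        ∙ ++⁺ˡ (copies j Γ₀) (↭-sym (concatMap-scaled j ps))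
  scale-premise : ∀ {p} → Premise D k p → Premise D (j * k) (map₁ (copies j) p)
  scale-premise {p} d = subst (D (copies j (proj₁ p))) (copies-replicate j k (proj₂ p)) (scale d)

□Premises-merge : ∀ {D} → (∀ {X Y} → D X [] → D Y [] → D (X ++ Y) []) →
                  □Premises D k Γ Φ → □Premises D k Γ′ Φ′ → □Premises D k (Γ ++ Γ′) (Φ ++ Φ′)
□Premises-merge {k = k} {Γ = Γ} {Γ′ = Γ′} mix
                (□premises Γ₀ ps e c d₀ ds) (□premises Γ₀′ ps′ e′ c′ d₀′ ds′) =
  □premises (Γ₀ ++ Γ₀′) (ps ++ ps′) split
    (↭-reflexive (List.map-++ proj₂ ps ps′) ∙ ++⁺ c c′)
    (mix d₀ d₀′) (All.++⁺ ds ds′)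
  where
  split : copies k (Γ ++ Γ′) ↭ (Γ₀ ++ Γ₀′) ++ concatMap proj₁ (ps ++ ps′)
  split = copies-++ k Γ Γ′ ∙ ++⁺ e e′
        ∙ ++-interchange Γ₀ (concatMap proj₁ ps) Γ₀′ (concatMap proj₁ ps′)
        ∙ ↭-reflexive (cong ((Γ₀ ++ Γ₀′) ++_) (sym (List.concatMap-++ proj₁ ps ps′)))

-- Mix cannot
-- be proved by plain structural recursion, because in the □/□ case it is
-- applied to scaled premises, which are not subderivations.
data GK≤ : ℕ → Derivable where
  ID    : Γ ↭ Δ → GK≤ n Γ Δ
  →⇒    : GK≤ n (ψ ∷ Γ) (φ ∷ Δ) → Γc ↭ (φ ⇒ ψ) ∷ Γ → Δc ↭ Δ → GK≤ n Γc Δc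
  ⇒→    : GK≤ n (φ ∷ Γ) (ψ ∷ Δ) → Γc ↭ Γ → Δc ↭ (φ ⇒ ψ) ∷ Δ → GK≤ n Γc Δc
  □rule : ∀ {C} → 1 ≤ k → □Premises (GK≤ n) k Γ Φ →
          Γc ↭ C ++ boxes Γ → Δc ↭ boxes Φ ++ C → GK≤ (suc n) Γc Δc

GK≤-resp-↭ : Γ ↭ Γ′ → Δ ↭ Δ′ → GK≤ n Γ Δ → GK≤ n Γ′ Δ′
GK≤-resp-↭ a b (ID p)            = ID (↭-sym a ∙ p ∙ b)
GK≤-resp-↭ a b (→⇒ d p q)        = →⇒ d (↭-sym a ∙ p) (↭-sym b ∙ q)
GK≤-resp-↭ a b (⇒→ d p q)        = ⇒→ d (↭-sym a ∙ p) (↭-sym b ∙ q)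
GK≤-resp-↭ a b (□rule k≥1 P p q) = □rule k≥1 P (↭-sym a ∙ p) (↭-sym b ∙ q)

mutual
  GK≤-mono : m ≤ n → GK≤ m Γ Δ → GK≤ n Γ Δ
  GK≤-mono m≤n (ID p)     = ID p
  GK≤-mono m≤n (→⇒ d p q) = →⇒ (GK≤-mono m≤n d) p q
  GK≤-mono m≤n (⇒→ d p q) = ⇒→ (GK≤-mono m≤n d) p q
  GK≤-mono (s≤s m≤n) (□rule k≥1 (□premises Γ₀ ps e c d₀ ds) p q) =
    □rule k≥1 (□premises Γ₀ ps e c (GK≤-mono m≤n d₀) (All-GK≤-mono m≤n ds)) p q

  All-GK≤-mono : ∀ {ps} → m ≤ n → All (Premise (GK≤ m) k) ps → All (Premise (GK≤ n) k) ps
  All-GK≤-mono m≤n []       = []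
  All-GK≤-mono m≤n (d ∷ ds) = GK≤-mono m≤n d ∷ All-GK≤-mono m≤n ds

mutual
  GK⇒GK≤ : GK Γ Δ → ∃ λ n → GK≤ n Γ Δ
  GK⇒GK≤ (ID p) = 0 , ID p
  GK⇒GK≤ (→⇒ d p q) = let n , d′ = GK⇒GK≤ d in n , →⇒ d′ p q
  GK⇒GK≤ (⇒→ d p q) = let n , d′ = GK⇒GK≤ d in n , ⇒→ d′ p q
  GK⇒GK≤ (□rule ps k≥1 e d₀ ds p q) =
    let a , d₀′ = GK⇒GK≤ d₀
        b , ds′ = All-GK⇒GK≤ ds
    in suc (a ⊔ b) ,
       □rule k≥1 (□premises _ ps e ↭-refl (GK≤-mono (m≤m⊔n a b) d₀′) (All-GK≤-mono (m≤n⊔m a b) ds′)) p q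

  All-GK⇒GK≤ : ∀ {ps} → All (Premise GK k) ps → ∃ λ n → All (Premise (GK≤ n) k) ps
  All-GK⇒GK≤ [] = 0 , []
  All-GK⇒GK≤ (d ∷ ds) =
    let a , d′ = GK⇒GK≤ d
        b , ds′ = All-GK⇒GK≤ ds
    in a ⊔ b , GK≤-mono (m≤m⊔n a b) d′ ∷ All-GK≤-mono (m≤n⊔m a b) ds′

mutual
  GK≤⇒GK : GK≤ n Γ Δ → GK Γ Δ
  GK≤⇒GK (ID p)     = ID p
  GK≤⇒GK (→⇒ d p q) = →⇒ (GK≤⇒GK d) p q
  GK≤⇒GK (⇒→ d p q) = ⇒→ (GK≤⇒GK d) p q
  GK≤⇒GK (□rule k≥1 (□premises Γ₀ ps e c d₀ ds) p q) =
    □-rule k≥1 (□premises Γ₀ ps e c (GK≤⇒GK d₀) (All-GK≤⇒GK ds)) p q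

  All-GK≤⇒GK : ∀ {ps} → All (Premise (GK≤ n) k) ps → All (Premise GK k) ps
  All-GK≤⇒GK []       = []
  All-GK≤⇒GK (d ∷ ds) = GK≤⇒GK d ∷ All-GK≤⇒GK ds

weaken : ∀ C → GK≤ n Π Σ → GK≤ n (C ++ Π) (Σ ++ C)
weaken {Σ = Σ} C (ID p) = ID (++⁺ˡ C p ∙ ↭-++-comm C Σ)
weaken C (→⇒ {ψ = ψ} {Γ = Π} d p q) =
  →⇒ (GK≤-resp-↭ (shift ψ C Π) ↭-refl (weaken C d)) (++⁺ˡ C p ∙ shift _ C Π) (++⁺ʳ C q)
weaken C (⇒→ {φ = φ} {Γ = Π} d p q) =
  ⇒→ (GK≤-resp-↭ (shift φ C Π) ↭-refl (weaken C d)) (++⁺ˡ C p) (++⁺ʳ C q)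
weaken C (□rule {Γ = G} {Φ = Φ} {C = C′} k≥1 P p q) =
  □rule {C = C ++ C′} k≥1 P
    (++⁺ˡ C p ∙ ↭-reflexive (sym (List.++-assoc C C′ (boxes G))))
    (++⁺ʳ C q ∙ ↭-reflexive (List.++-assoc (boxes Φ) C′ C) ∙ ++⁺ˡ (boxes Φ) (↭-++-comm C′ C))

mutual
  mix : ∀ n {Γ Δ Π Σ} → GK≤ n Γ Δ → GK≤ n Π Σ → GK≤ n (Γ ++ Π) (Σ ++ Δ)
  mix n {Γ = Γ} {Σ = Σ} (ID p) d₂ = GK≤-resp-↭ ↭-refl (++⁺ˡ Σ p) (weaken Γ d₂)
  mix n {Π = Π} {Σ = Σ} (→⇒ {φ = φ} {Δ = Δ} d p q) d₂ =
    →⇒ (GK≤-resp-↭ ↭-refl (shift φ Σ Δ) (mix n d d₂)) (++⁺ʳ Π p) (++⁺ˡ Σ q)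
  mix n {Π = Π} {Σ = Σ} (⇒→ {ψ = ψ} {Δ = Δ} d p q) d₂ =
    ⇒→ (GK≤-resp-↭ ↭-refl (shift ψ Σ Δ) (mix n d d₂)) (++⁺ʳ Π p) (++⁺ˡ Σ q ∙ shift _ Σ Δ)
  mix (suc m) {Γ} {Δ} {Π} d₁@(□rule _ _ _ _) (ID p) =
    GK≤-resp-↭ (↭-++-comm Π Γ) (↭-++-comm Δ Π ∙ ++⁺ʳ Δ p) (weaken Π d₁)
  mix (suc m) {Γ} {Δ} d₁@(□rule _ _ _ _) (→⇒ {ψ = ψ} {Γ = Π} d p q) =
    →⇒ (GK≤-resp-↭ (shift ψ Γ Π) ↭-refl (mix (suc m) d₁ d)) (++⁺ˡ Γ p ∙ shift _ Γ Π) (++⁺ʳ Δ q)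
  mix (suc m) {Γ} {Δ} d₁@(□rule _ _ _ _) (⇒→ {φ = φ} {Γ = Π} d p q) =
    ⇒→ (GK≤-resp-↭ (shift φ Γ Π) ↭-refl (mix (suc m) d₁ d)) (++⁺ˡ Γ p) (++⁺ʳ Δ q)
  mix (suc m) {Γ} {Δ} {Π} {Σ} (□rule {k = k₁} {Γ = G₁} {Φ = Φ₁} {C = C₁} k₁≥1 P₁ p₁ q₁)
              (□rule {k = k₂} {Γ = G₂} {Φ = Φ₂} {C = C₂} k₂≥1 P₂ p₂ q₂) =
    □rule (*-mono-≤ k₂≥1 k₁≥1) (□Premises-merge (mix m) P₁′ P₂′) antecedents succedents
    where
    P₁′ : □Premises (GK≤ m) (k₂ * k₁) G₁ Φ₁
    P₁′ = □Premises-scale k₂ (scale m k₂) P₁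
    P₂′ : □Premises (GK≤ m) (k₂ * k₁) G₂ Φ₂
    P₂′ = subst (λ k → □Premises (GK≤ m) k G₂ Φ₂) (*-comm k₁ k₂)
                (□Premises-scale k₁ (scale m k₁) P₂)
    antecedents : Γ ++ Π ↭ (C₁ ++ C₂) ++ boxes (G₁ ++ G₂)
    antecedents = ++⁺ p₁ p₂ ∙ ++-interchange C₁ (boxes G₁) C₂ (boxes G₂)
                ∙ ↭-reflexive (cong ((C₁ ++ C₂) ++_) (sym (List.map-++ □_ G₁ G₂)))
    succedents : Σ ++ Δ ↭ boxes (Φ₁ ++ Φ₂) ++ (C₁ ++ C₂)
    succedents = ++⁺ q₂ q₁ ∙ ↭-++-comm (boxes Φ₂ ++ C₂) (boxes Φ₁ ++ C₁)
               ∙ ++-interchange (boxes Φ₁) C₁ (boxes Φ₂) C₂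
               ∙ ↭-reflexive (cong (_++ (C₁ ++ C₂)) (sym (List.map-++ □_ Φ₁ Φ₂)))

  scale : ∀ n k {Γ Δ} → GK≤ n Γ Δ → GK≤ n (copies k Γ) (copies k Δ)
  scale n zero    d = ID ↭-refl
  scale n (suc k) {Δ = Δ} d = GK≤-resp-↭ ↭-refl (↭-++-comm (copies k Δ) Δ) (mix n d (scale n k d))

mix-admissible : GK Γ Δ → GK Π Σ → GK (Γ ++ Π) (Σ ++ Δ)
mix-admissible d₁ d₂ =
  let a , d₁′ = GK⇒GK≤ d₁
      b , d₂′ = GK⇒GK≤ d₂
  in GK≤⇒GK (mix (a ⊔ b) (GK≤-mono (m≤m⊔n a b) d₁′) (GK≤-mono (m≤n⊔m a b) d₂′))

⇒∉boxes : ∀ G → (φ ⇒ ψ) ∉ boxes G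
⇒∉boxes G ∈G with ∈-map⁻ □_ ∈G
... | _ , _ , ()

∈-context⁻ : ∀ C G → (φ ⇒ ψ) ∈ C ++ boxes G → (φ ⇒ ψ) ∈ C
∈-context⁻ C G ∈CG with ∈-++⁻ C ∈CG
... | inj₁ ∈C = ∈C
... | inj₂ ∈G = ⊥-elim (⇒∉boxes G ∈G)

∈-context⁻′ : ∀ C G → (φ ⇒ ψ) ∈ boxes G ++ C → (φ ⇒ ψ) ∈ C
∈-context⁻′ C G ∈GC with ∈-++⁻ (boxes G) ∈GC
... | inj₁ ∈G = ⊥-elim (⇒∉boxes G ∈G)
... | inj₂ ∈C = ∈C

-- Inversion of an implication occurring in the context (on both sides): mix
-- with the derivable sequents ψ ⊢ φ ⇒ ψ, φ and φ ⇒ ψ, φ ⊢ ψ respectively.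
→⇒-inversion-context : GK Γ Δ → GK (ψ ∷ Γ) (φ ∷ (φ ⇒ ψ) ∷ Δ)
→⇒-inversion-context {Δ = Δ} {ψ = ψ} {φ = φ} d =
  GK-resp-↭ ↭-refl (↭-++-comm Δ ((φ ⇒ ψ) ∷ [ φ ]) ∙ swap _ _ ↭-refl)
    (mix-admissible (⇒→ (ID (swap φ ψ ↭-refl)) ↭-refl ↭-refl) d)

⇒→-inversion-context : GK Γ Δ → GK (φ ∷ (φ ⇒ ψ) ∷ Γ) (ψ ∷ Δ)
⇒→-inversion-context {Δ = Δ} {φ = φ} {ψ = ψ} d =
  GK-resp-↭ (swap _ _ ↭-refl) (↭-++-comm Δ [ ψ ])
    (mix-admissible (→⇒ (ID (swap ψ φ ↭-refl)) ↭-refl ↭-refl) d)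

→⇒-inversion : GK Γc Δc → Γc ↭ (φ ⇒ ψ) ∷ Γ → GK (ψ ∷ Γ) (φ ∷ Δc)
→⇒-inversion {φ = φ} (ID p) r =
  GK-resp-↭ ↭-refl (prep φ (↭-sym r ∙ p)) (→⇒-inversion-context (ID ↭-refl))
→⇒-inversion {φ = φ} {ψ = ψ} (→⇒ {ψ = ψ′} d p q) r
  with ∈-resp-↭ (↭-sym r ∙ p) (here refl)
... | here refl = GK-resp-↭ (prep ψ (drop-∷ (↭-sym p ∙ r))) (prep φ (↭-sym q)) d
... | there ∈Γ₁ with Γ₂ , s ← ∈⇒↭∷ ∈Γ₁ =
  →⇒ (GK-resp-↭ (swap ψ ψ′ ↭-refl) (swap φ _ ↭-refl)
        (→⇒-inversion d (prep ψ′ s ∙ swap ψ′ _ ↭-refl)))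
     (prep ψ (drop-∷ (↭-sym r ∙ p ∙ prep _ s ∙ swap _ _ ↭-refl)) ∙ swap ψ _ ↭-refl)
     (prep φ q)
→⇒-inversion {φ = φ} {ψ = ψ} (⇒→ {φ = φ′} d p q) r
  with Γ₂ , s ← ∈⇒↭∷ (∈-resp-↭ (↭-sym r ∙ p) (here refl)) =
  ⇒→ (GK-resp-↭ (swap ψ φ′ ↭-refl) (swap φ _ ↭-refl)
        (→⇒-inversion d (prep φ′ s ∙ swap φ′ _ ↭-refl)))
     (prep ψ (drop-∷ (↭-sym r ∙ p ∙ s)))
     (prep φ q ∙ swap φ _ ↭-refl)
→⇒-inversion {φ = φ} (□rule {Γ = G} {Δ = C} ps k≥1 e d₀ ds p q) r
  with C₂ , s ← ∈⇒↭∷ (∈-context⁻ C G (∈-resp-↭ (↭-sym r ∙ p) (here refl))) =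
  GK-resp-↭ (prep _ (↭-sym (drop-∷ (↭-sym r ∙ p ∙ ++⁺ʳ (boxes G) s))))
            (prep φ (↭-sym (q ∙ ++⁺ˡ (boxes (map proj₂ ps)) s ∙ shift _ (boxes (map proj₂ ps)) C₂)))
    (→⇒-inversion-context (□rule {Δ = C₂} ps k≥1 e d₀ ds ↭-refl ↭-refl))

⇒→-inversion : GK Γc Δc → Δc ↭ (φ ⇒ ψ) ∷ Δ → GK (φ ∷ Γc) (ψ ∷ Δ)
⇒→-inversion {ψ = ψ} (ID p) r =
  GK-resp-↭ (prep _ (↭-sym (p ∙ r))) ↭-refl (⇒→-inversion-context (ID ↭-refl))
⇒→-inversion {φ = φ} {ψ = ψ} (→⇒ {φ = φ′} d p q) r =
  →⇒ (GK-resp-↭ (swap φ _ ↭-refl) (swap ψ φ′ ↭-refl)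
        (⇒→-inversion d (prep φ′ (↭-sym q ∙ r) ∙ swap φ′ _ ↭-refl)))
     (prep φ p ∙ swap φ _ ↭-refl)
     ↭-refl
⇒→-inversion {φ = φ} {ψ = ψ} (⇒→ {ψ = ψ′} d p q) r
  with ∈-resp-↭ (↭-sym r ∙ q) (here refl)
... | here refl = GK-resp-↭ (prep φ (↭-sym p)) (prep ψ (drop-∷ (↭-sym q ∙ r))) d
... | there ∈Δ₁ with Δ₂ , s ← ∈⇒↭∷ ∈Δ₁ =
  ⇒→ (GK-resp-↭ (swap φ _ ↭-refl) (swap ψ ψ′ ↭-refl)
        (⇒→-inversion d (prep ψ′ s ∙ swap ψ′ _ ↭-refl)))
     (prep φ p)
     (prep ψ (drop-∷ (↭-sym r ∙ q ∙ prep _ s ∙ swap _ _ ↭-refl)) ∙ swap ψ _ ↭-refl)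
⇒→-inversion {ψ = ψ} (□rule {Γ = G} {Δ = C} ps k≥1 e d₀ ds p q) r
  with C₂ , s ← ∈⇒↭∷ (∈-context⁻′ C (map proj₂ ps) (∈-resp-↭ (↭-sym r ∙ q) (here refl))) =
  GK-resp-↭ (prep _ (↭-sym (p ∙ ++⁺ʳ (boxes G) s)))
            (prep ψ (↭-sym (drop-∷ (↭-sym r ∙ q ∙ ++⁺ˡ (boxes (map proj₂ ps)) s
                                    ∙ shift _ (boxes (map proj₂ ps)) C₂))))
    (⇒→-inversion-context (□rule {Δ = C₂} ps k≥1 e d₀ ds ↭-refl ↭-refl))

→⇒-inversion-replicate : ∀ j Γ Δ → GK (replicate j (φ ⇒ ψ) ++ Γ) Δ →
                         GK (replicate j ψ ++ Γ) (replicate j φ ++ Δ)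
→⇒-inversion-replicate zero    Γ Δ d = d
→⇒-inversion-replicate {φ = φ} {ψ = ψ} (suc j) Γ Δ d =
  GK-resp-↭ (shift ψ (replicate j ψ) Γ) (shift φ (replicate j φ) Δ)
    (→⇒-inversion-replicate j (ψ ∷ Γ) (φ ∷ Δ)
      (GK-resp-↭ (↭-sym (shift ψ (replicate j (φ ⇒ ψ)) Γ)) ↭-refl (→⇒-inversion d ↭-refl)))

⇒→-inversion-replicate : ∀ j Γ Δ → GK Γ (replicate j (φ ⇒ ψ) ++ Δ) →
                         GK (replicate j φ ++ Γ) (replicate j ψ ++ Δ)
⇒→-inversion-replicate zero    Γ Δ d = d
⇒→-inversion-replicate {φ = φ} {ψ = ψ} (suc j) Γ Δ d =
  GK-resp-↭ (shift φ (replicate j φ) Γ) (shift ψ (replicate j ψ) Δ)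
    (⇒→-inversion-replicate j (φ ∷ Γ) (ψ ∷ Δ)
      (GK-resp-↭ ↭-refl (↭-sym (shift ψ (replicate j (φ ⇒ ψ)) Δ)) (⇒→-inversion d ↭-refl)))

→⇒-inversion-copies : ∀ k → Γ ↭ (φ ⇒ ψ) ∷ Γ′ → GK (copies k Γ) (copies k Δ) →
                      GK (copies k (ψ ∷ Γ′)) (copies k (φ ∷ Δ))
→⇒-inversion-copies k r d =
  GK-resp-↭ (↭-sym (copies-∷ k _ _)) (↭-sym (copies-∷ k _ _))
    (→⇒-inversion-replicate k _ _ (GK-resp-↭ (copies⁺ k r ∙ copies-∷ k _ _) ↭-refl d))

⇒→-inversion-copies : ∀ k → Δ ↭ (φ ⇒ ψ) ∷ Δ′ → GK (copies k Γ) (copies k Δ) →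
                      GK (copies k (φ ∷ Γ)) (copies k (ψ ∷ Δ′))
⇒→-inversion-copies k r d =
  GK-resp-↭ (↭-sym (copies-∷ k _ _)) (↭-sym (copies-∷ k _ _))
    (⇒→-inversion-replicate k _ _ (GK-resp-↭ ↭-refl (copies⁺ k r ∙ copies-∷ k _ _) d))

⇒-count : Formula → ℕ
⇒-count (var _) = 0
⇒-count (φ ⇒ ψ) = suc (⇒-count φ + ⇒-count ψ)
⇒-count (□ _)   = 0

⇒-size : List Formula → ℕ
⇒-size Γ = sum (map ⇒-count Γ)

⇒-size-decreases : Γ ↭ (φ ⇒ ψ) ∷ Π → Δ ↭ φ ∷ ψ ∷ Π → ⇒-size Δ < ⇒-size Γ
⇒-size-decreases {φ = φ} {ψ = ψ} {Π = Π} p q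
  rewrite sum-↭ (↭-map⁺ ⇒-count p) | sum-↭ (↭-map⁺ ⇒-count q) =
  s≤s (≤-reflexive (sym (+-assoc (⇒-count φ) (⇒-count ψ) (⇒-size Π))))

data IsImplication : Formula → Set where
  imp : IsImplication (φ ⇒ ψ)

isImplication? : Decidable IsImplication
isImplication? (var _) = no λ ()
isImplication? (φ ⇒ ψ) = yes imp
isImplication? (□ _)   = no λ ()

extract-implication : Any IsImplication Γ → ∃₂ λ φ ψ → ∃ λ Γ′ → Γ ↭ (φ ⇒ ψ) ∷ Γ′
extract-implication any with _ , ∈Γ , imp ← find any = _ , _ , ∈⇒↭∷ ∈Γ

nonBox : Formula → List Formula
nonBox (□ _) = []
nonBox φ     = [ φ ]

unbox : Formula → List Formula
unbox (□ φ) = [ φ ]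
unbox _     = []

↭-nonBoxes++boxes : ∀ Γ → Γ ↭ concatMap nonBox Γ ++ boxes (concatMap unbox Γ)
↭-nonBoxes++boxes []            = ↭-refl
↭-nonBoxes++boxes (var x ∷ Γ)   = prep _ (↭-nonBoxes++boxes Γ)
↭-nonBoxes++boxes ((φ ⇒ ψ) ∷ Γ) = prep _ (↭-nonBoxes++boxes Γ)
↭-nonBoxes++boxes (□ φ ∷ Γ)     = prep (□ φ) (↭-nonBoxes++boxes Γ) ∙ ↭-sym (shift (□ φ) _ _)

nonBoxes-boxes : ∀ G → concatMap nonBox (boxes G) ≡ []
nonBoxes-boxes []      = refl
nonBoxes-boxes (_ ∷ G) = nonBoxes-boxes G

unboxes-boxes : ∀ G → concatMap unbox (boxes G) ≡ G
unboxes-boxes []      = refl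
unboxes-boxes (φ ∷ G) = cong (φ ∷_) (unboxes-boxes G)

nonBoxes-++boxes : ∀ C G → concatMap nonBox (C ++ boxes G) ≡ concatMap nonBox C
nonBoxes-++boxes C G =
  trans (List.concatMap-++ nonBox C (boxes G)) (trans (cong (_ ++_) (nonBoxes-boxes G)) (List.++-identityʳ _))

nonBoxes-boxes++ : ∀ G C → concatMap nonBox (boxes G ++ C) ≡ concatMap nonBox C
nonBoxes-boxes++ G C = trans (List.concatMap-++ nonBox (boxes G) C) (cong (_++ _) (nonBoxes-boxes G))

unboxes-++boxes : ∀ C G → concatMap unbox (C ++ boxes G) ≡ concatMap unbox C ++ G
unboxes-++boxes C G = trans (List.concatMap-++ unbox C (boxes G)) (cong (_ ++_) (unboxes-boxes G))

unboxes-boxes++ : ∀ G C → concatMap unbox (boxes G ++ C) ≡ G ++ concatMap unbox C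
unboxes-boxes++ G C = trans (List.concatMap-++ unbox (boxes G) C) (cong (_++ _) (unboxes-boxes G))

□Premises-absorb : ∀ B → □Premises GK k Γ Φ → □Premises GK k (B ++ Γ) (B ++ Φ)
□Premises-absorb {k = k} {Γ = Γ} B (□premises Γ₀ ps e c d₀ ds) =
  □premises Γ₀ (identities ++ ps) split
    (↭-reflexive (List.map-++ proj₂ identities ps)
     ∙ ++⁺ (↭-reflexive (trans (sym (List.map-∘ B)) (List.map-id B))) c)
    d₀ (All.++⁺ (All.map⁺ (All.tabulate λ _ → ID ↭-refl)) ds)
  where
  identities : List (List Formula × Formula)
  identities = map (λ φ → replicate k φ , φ) B
  split : copies k (B ++ Γ) ↭ Γ₀ ++ concatMap proj₁ (identities ++ ps)
  split = copies-++ k B Γ ∙ ++⁺ˡ (copies k B) e ∙ shifts (copies k B) Γ₀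
        ∙ ++⁺ˡ Γ₀ (++⁺ʳ (concatMap proj₁ ps)
                     (copies↭concatMap-replicate k B ∙ ↭-reflexive (cong concat (List.map-∘ B))))
        ∙ ↭-reflexive (cong (Γ₀ ++_) (sym (List.concatMap-++ proj₁ identities ps)))

mix-premises : ∀ {k φ} n (Q : List (List Formula × Formula)) → map proj₂ Q ≡ replicate n φ →
               All (Premise GK k) Q → GK (concatMap proj₁ Q) (copies n (replicate k φ))
mix-premises zero    []             _  []       = ID ↭-refl
mix-premises {k} (suc n) ((Γ , ψ) ∷ Q) eq (d ∷ ds) with refl , eq′ ← List.∷-injective eq =
  GK-resp-↭ ↭-refl (↭-++-comm (copies n (replicate k ψ)) (replicate k ψ))
    (mix-admissible d (mix-premises n Q eq′ ds))

group-premises : ∀ n k Φ (ps : List (List Formula × Formula)) → map proj₂ ps ≡ concatMap (replicate n) Φ →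
                 All (Premise GK k) ps →
                 ∃ λ qs → map proj₂ qs ≡ Φ × All (Premise GK (n * k)) qs
                        × concatMap proj₁ qs ≡ concatMap proj₁ ps
group-premises n k []      []       _  _  = [] , refl , [] , refl
group-premises n k (φ ∷ Φ) ps       eq ds
  with Q , R , refl , eqQ , eqR ← map-≡-++ proj₂ (replicate n φ) (concatMap (replicate n) Φ) ps eq
  with dsQ , dsR ← All.++⁻ Q ds
  with qs , eqs , dqs , cqs ← group-premises n k Φ R eqR dsR =
  (concatMap proj₁ Q , φ) ∷ qs ,
  cong (φ ∷_) eqs ,
  subst (GK _) (copies-replicate n k φ) (mix-premises n Q eqQ dsQ) ∷ dqs ,
  trans (cong (concatMap proj₁ Q ++_) cqs) (sym (List.concatMap-++ proj₁ Q R))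

□Premises-group : ∀ n → □Premises GK k (copies n Γ) (copies n Φ) → □Premises GK (n * k) Γ Φ
□Premises-group {k = k} {Γ = Γ} {Φ = Φ} n (□premises Γ₀ ps e c d₀ ds)
  with ps′ , eq , ps↭ps′ ← ↭-map-inv proj₂ (c ∙ copies↭concatMap-replicate n Φ)
  with qs , eqs , dqs , cqs ← group-premises n k Φ ps′ (sym eq) (All-resp-↭ ps↭ps′ ds) =
  □premises Γ₀ qs
    (↭-reflexive (trans (copies-* n k Γ) (copies-comm n k Γ)) ∙ e
     ∙ ++⁺ˡ Γ₀ (concatMap⁺ proj₁ ps↭ps′ ∙ ↭-reflexive (sym cqs)))
    (↭-reflexive eqs) d₀ dqs

sc-□rule : ∀ n {k G Φ C} → 1 ≤ k → □Premises GK k G Φ →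
       copies (suc n) Γ ↭ C ++ boxes G → copies (suc n) Δ ↭ boxes Φ ++ C → GK Γ Δ
sc-□rule {Γ} {Δ} n {k} {G} {Φ} {C} k≥1 P p q =
  □-rule (*-mono-≤ (s≤s (z≤n {n})) k≥1) (□Premises-group (suc n) P′)
    (↭-nonBoxes++boxes Γ)
    (↭-nonBoxes++boxes Δ ∙ ↭-++-comm (concatMap nonBox Δ) _ ∙ ++⁺ˡ _ nonBoxes-agree)
  where
  nonBoxes-agree : concatMap nonBox Δ ↭ concatMap nonBox Γ
  nonBoxes-agree = copies-cancel n
    (concatMap-copies⁺ nonBox (suc n) q ∙ ↭-reflexive (trans (nonBoxes-boxes++ Φ C) (sym (nonBoxes-++boxes C G)))
     ∙ ↭-sym (concatMap-copies⁺ nonBox (suc n) p))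
  B = concatMap unbox C
  P′ : □Premises GK k (copies (suc n) (concatMap unbox Γ)) (copies (suc n) (concatMap unbox Δ))
  P′ = □Premises-resp-↭
    (↭-sym (concatMap-copies⁺ unbox (suc n) p ∙ ↭-reflexive (unboxes-++boxes C G)))
    (↭-sym (concatMap-copies⁺ unbox (suc n) q ∙ ↭-reflexive (unboxes-boxes++ Φ C) ∙ ↭-++-comm Φ B))
    (□Premises-absorb B P)

sc-implication-free : ∀ n → ¬ Any IsImplication Γ → ¬ Any IsImplication Δ →
                      GK (copies (suc n) Γ) (copies (suc n) Δ) → GK Γ Δ
sc-implication-free n _ _ (ID p) = ID (copies-cancel n p)
sc-implication-free n ¬impΓ _ (→⇒ _ p _) =
  ⊥-elim (¬impΓ (lose (∈-copies⁻ (suc n) (∈-resp-↭ (↭-sym p) (here refl))) imp))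
sc-implication-free n _ ¬impΔ (⇒→ _ _ q) =
  ⊥-elim (¬impΔ (lose (∈-copies⁻ (suc n) (∈-resp-↭ (↭-sym q) (here refl))) imp))
sc-implication-free n _ _ (□rule ps k≥1 e d₀ ds p q) = sc-□rule n k≥1 (□premises _ ps e ↭-refl d₀ ds) p q

sc-admissible : ∀ n Γ Δ → GK (copies (suc n) Γ) (copies (suc n) Δ) → GK Γ Δ
sc-admissible n Γ Δ = go Γ Δ (<-wellFounded _)
  where
  go : ∀ Γ Δ → Acc _<_ (⇒-size (Γ ++ Δ)) → GK (copies (suc n) Γ) (copies (suc n) Δ) → GK Γ Δ
  go Γ Δ (acc smaller) d with any? isImplication? Γ | any? isImplication? Δ
  ... | yes impΓ | _ with φ , ψ , Γ′ , r ← extract-implication impΓ =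
    →⇒ (go (ψ ∷ Γ′) (φ ∷ Δ)
          (smaller (⇒-size-decreases (++⁺ʳ Δ r) (prep ψ (shift φ Γ′ Δ) ∙ swap ψ φ ↭-refl)))
          (→⇒-inversion-copies (suc n) r d))
       r ↭-refl
  ... | no _ | yes impΔ with φ , ψ , Δ′ , r ← extract-implication impΔ =
    ⇒→ (go (φ ∷ Γ) (ψ ∷ Δ′)
          (smaller (⇒-size-decreases (++⁺ˡ Γ r ∙ shift _ Γ Δ′) (prep φ (shift ψ Γ Δ′))))
          (⇒→-inversion-copies (suc n) r d))
       ↭-refl r
  ... | no ¬impΓ | no ¬impΔ = sc-implication-free n ¬impΓ ¬impΔ d

lemma4p5 : (∀ (Γ Δ Π Σ : List Formula) → GK Γ Δ → GK Π Σ → GK (Γ ++ Π) (Σ ++ Δ))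
           × (∀ (n : ℕ) → 2 ≤ n → ∀ (Γ Δ : List Formula) → GK (copies n Γ) (copies n Δ) → GK Γ Δ)
lemma4p5 = (λ _ _ _ _ → mix-admissible) , λ { (suc n) _ → sc-admissible n }
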